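{- Let $\mathcal{Q}$ and $\mathcal{Q}'$ be seminormal quasi-crystals of type $A_{n-1}$ satisfying the local quasi-crystal axioms LQ1, LQ2, LQ3, LQ3$'$. Then the quasi-tensor product $\mathcal{Q}\mathbin{\ddot\otimes}\mathcal{Q}'$ satisfies the same axioms.
   Context: Fix $n\ge 2$, $I=\{1,\dots,n-1\}$, weights in $\mathbb{Z}^n$ with standard inner product, $\alpha_i=\mathbf{e}_i-\mathbf{e}_{i+1}$; on $\mathbb{Z}\sqcup\{\pm\infty\}$, $m+(\pm\infty)=\pm\infty$. A quasi-crystal of type $A_{n-1}$ is a non-empty set $\mathcal{Q}$ with maps $\ddot e_i,\ddot f_i:\mathcal{Q}\to\mathcal{Q}\sqcup\{\bot\}$, $\ddot\varepsilon_i,\ddot\varphi_i:\mathcal{Q}\to\mathbb{Z}\sqcup\{\pm\infty\}$, $\mathrm{wt}:\mathcal{Q}\to\mathbb{Z}^n$ with: (Q1) $\ddot e_i(x)=y\iff x=\ddot f_i(y)$, and then $\mathrm{wt}(y)=\mathrm{wt}(x)+\alpha_i$, $\ddot\varepsilon_i(y)=\ddot\varepsilon_i(x)-1$, $\ddot\varphi_i(y)=\ddot\varphi_i(x)+1$; (Q2) $\ddot\varphi_i(x)=\ddot\varepsilon_i(x)+\langle\mathrm{wt}(x),\alpha_i\rangle$; (Q3),(Q4) if $\ddot\varepsilon_i(x)=\pm\infty$ then $\ddot e_i(x)=\ddot f_i(x)=\bot$. Seminormal: whenever $\ddot\varepsilon_i(x)\ne+\infty$, $\ddot\varepsilon_i(x)=\max\{k:\ddot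 e_i^k(x)\ne\bot\}$ and $\ddot\varphi_i(x)=\max\{k:\ddot f_i^k(x)\ne\bot\}$. Local axioms (all $i,j\in I$, $x,y$): (LQ1) for $i+1\in I$: $\ddot\varepsilon_i(x)=0\iff\ddot\varphi_{i+1}(x)=0$. (LQ2) if $\ddot e_i(x)=y$: (1) $\ddot\varepsilon_j(x)=\ddot\varepsilon_j(y)$ for $|i-j|>1$; (2) if $i+1\in I$: $\ddot\varepsilon_{i+1}(x)\ne\ddot\varepsilon_{i+1}(y)$ iff ($\ddot\varepsilon_{i+1}(x)=+\infty$ and $\ddot\varepsilon_i(y)=0$), and then $\ddot\varepsilon_{i+1}(y)\ne0$; (3) if $i-1\in I$: $\ddot\varphi_{i-1}(x)\ne\ddot\varphi_{i-1}(y)$ iff ($\ddot\varphi_{i-1}(y)=+\infty$ and $\ddot\varphi_i(x)=0$), and then $\ddot\varphi_{i-1}(x)\ne0$. (LQ3) for $i\ne j$, if $\ddot e_i(x)\ne\bot\ne\ddot e_j(x)$ then $\ddot e_i\ddot e_j(x)=\ddot e_j\ddot e_i(x)\ne\bot$. (LQ3$'$) same with $\ddot f$. Quasi-tensor product: $\mathcal{Q}\mathbin{\ddot\otimes}\mathcal{Q}'$ is the set of pairs $x\mathbin{\ddot\otimes}x'$ ($x\in\mathcal{Q}$, $x'\in\mathcal{Q}'$) with $\mathrm{wt}(x\mathbin{\ddot\otimes}x')=\mathrm{wt}(x)+\mathrm{wt}(x')$ and, for each $i$: if $\ddot\varphi_i(x)>0$ and $\ddot\varepsilon_i(x')>0$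 then $\ddot e_i(x\mathbin{\ddot\otimes}x')=\ddot f_i(x\mathbin{\ddot\otimes}x')=\bot$ and $\ddot\varepsilon_i(x\mathbin{\ddot\otimes}x')=\ddot\varphi_i(x\mathbin{\ddot\otimes}x')=+\infty$; otherwise $\ddot e_i(x\mathbin{\ddot\otimes}x')=\ddot e_i(x)\mathbin{\ddot\otimes}x'$ if $\ddot\varphi_i(x)\ge\ddot\varepsilon_i(x')$ and $=x\mathbin{\ddot\otimes}\ddot e_i(x')$ if $\ddot\varphi_i(x)<\ddot\varepsilon_i(x')$; $\ddot f_i(x\mathbin{\ddot\otimes}x')=\ddot f_i(x)\mathbin{\ddot\otimes}x'$ if $\ddot\varphi_i(x)>\ddot\varepsilon_i(x')$ and $=x\mathbin{\ddot\otimes}\ddot f_i(x')$ if $\ddot\varphi_i(x)\le\ddot\varepsilon_i(x')$; $\ddot\varepsilon_i(x\mathbin{\ddot\otimes}x')=\max\{\ddot\varepsilon_i(x),\ddot\varepsilon_i(x')-\langle\mathrm{wt}(x),\alpha_i\rangle\}$ and $\ddot\varphi_i(x\mathbin{\ddot\otimes}x')=\max\{\ddot\varphi_i(x)+\langle\mathrm{wt}(x'),\alpha_i\rangle,\ddot\varphi_i(x')\}$; here $x\mathbin{\ddot\otimes}\bot=\bot\mathbin{\ddot\otimes}x'=\bot$. This is a seminormal quasi-crystal of type $A_{n-1}$. -}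

module Defs where

open import Data.Nat as ℕ using (ℕ; zero; suc; pred; _<_; _≤_)
open import Data.Integer as ℤ using (ℤ; +_; -_)
open import Data.Fin as Fin using (Fin; toℕ; inject₁)
open import Data.Vec using (Vec; zipWith; tabulate; foldr′)
open import Data.Maybe using (Maybe; just; nothing; _>>=_; map)
open import Data.Bool using (Bool; true; false; if_then_else_; _∧_)
open import Data.Product using (_×_; _,_; Σ; ∃)
open import Data.Sum using (_⊎_)
open import Relation.Nullary using (¬_; does)
open import Relation.Binary.PropositionalEquality using (_≡_; _≢_)

data ℤ∞ : Set where
  fin : ℤ → ℤ∞
  ∞⁺  : ℤ∞
  ∞⁻  : ℤ∞

_⊕_ : ℤ∞ → ℤ → ℤ∞
fin a ⊕ m = fin (a ℤ.+ m)
∞⁺ ⊕ m = ∞⁺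
∞⁻ ⊕ m = ∞⁻

_≤ᵇ_ : ℤ∞ → ℤ∞ → Bool
∞⁻ ≤ᵇ _ = true
_ ≤ᵇ ∞⁺ = true
fin a ≤ᵇ fin b = does (a ℤ.≤? b)
fin _ ≤ᵇ ∞⁻ = false
∞⁺ ≤ᵇ fin _ = false
∞⁺ ≤ᵇ ∞⁻ = false

_<ᵇ_ : ℤ∞ → ℤ∞ → Bool
a <ᵇ b = if b ≤ᵇ a then false else true

max∞ : ℤ∞ → ℤ∞ → ℤ∞
max∞ a b = if a ≤ᵇ b then b else a

Wt : ℕ → Set
Wt n = Vec ℤ n

𝐞 : {n : ℕ} → Fin n → Wt n
𝐞 j = tabulate (λ k → if does (k Fin.≟ j) then + 1 else + 0)

_+ᵥ_ : {n : ℕ} → Wt n → Wt n → Wt n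
_+ᵥ_ = zipWith ℤ._+_

_-ᵥ_ : {n : ℕ} → Wt n → Wt n → Wt n
_-ᵥ_ = zipWith ℤ._-_

⟨_,_⟩ : {n : ℕ} → Wt n → Wt n → ℤ
⟨ v , w ⟩ = foldr′ ℤ._+_ (+ 0) (zipWith ℤ._*_ v w)

-- index i : Fin (pred n) stands for the element toℕ i + 1 of I = {1,…,n-1}
-- α_i = e_i - e_{i+1}
α : (n : ℕ) → Fin (pred n) → Wt n
α zero ()
α (suc k) i = 𝐞 (inject₁ i) -ᵥ 𝐞 (Fin.suc i)

-- raw quasi-crystal data; ⊥ is `nothing`

record QData (n : ℕ) : Set₁ where
  field
    Carrier : Set
    ë f̈ : Fin (pred n) → Carrier → Maybe Carrier
    ε̈ φ̈ : Fin (pred n) → Carrier → ℤ∞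
    wt : Carrier → Wt n

iter : {A : Set} → (A → Maybe A) → ℕ → A → Maybe A
iter g zero x = just x
iter g (suc k) x = iter g k x >>= g

IsMax : (ℕ → Set) → ℕ → Set
IsMax P k = P k × (∀ j → P j → j ≤ k)

module _ {n : ℕ} (Q : QData n) where
  open QData Q

  record IsQuasiCrystal : Set where
    field
      nonempty : Carrier
      Q1⇒ : ∀ i x y → ë i x ≡ just y → f̈ i y ≡ just x
      Q1⇐ : ∀ i x y → f̈ i y ≡ just x → ë i x ≡ just y
      Q1-wt : ∀ i x y → ë i x ≡ just y → wt y ≡ wt x +ᵥ α n i
      Q1-ε : ∀ i x y → ë i x ≡ just y → ε̈ i y ≡ ε̈ i x ⊕ (- + 1)
      Q1-φ : ∀ i x y → ë i x ≡ just y → φ̈ i y ≡ φ̈ i x ⊕ (+ 1)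
      Q2 : ∀ i x → φ̈ i x ≡ ε̈ i x ⊕ ⟨ wt x , α n i ⟩
      Q3 : ∀ i x → ε̈ i x ≡ ∞⁺ → ë i x ≡ nothing × f̈ i x ≡ nothing
      Q4 : ∀ i x → ε̈ i x ≡ ∞⁻ → ë i x ≡ nothing × f̈ i x ≡ nothing

  IsSeminormal : Set
  IsSeminormal = ∀ i x → ε̈ i x ≢ ∞⁺ →
      (∃ λ k → IsMax (λ j → iter (ë i) j x ≢ nothing) k × ε̈ i x ≡ fin (+ k))
    × (∃ λ k → IsMax (λ j → iter (f̈ i) j x ≢ nothing) k × φ̈ i x ≡ fin (+ k))

  Next : Fin (pred n) → Fin (pred n) → Set
  Next i j = toℕ j ≡ suc (toℕ i)

  Far : Fin (pred n) → Fin (pred n) → Set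
  Far i j = (suc (toℕ i) < toℕ j) ⊎ (suc (toℕ j) < toℕ i)

  record LocalAxioms : Set where
    field
      LQ1 : ∀ i j x → Next i j → (ε̈ i x ≡ fin (+ 0) → φ̈ j x ≡ fin (+ 0))
                                × (φ̈ j x ≡ fin (+ 0) → ε̈ i x ≡ fin (+ 0))
      LQ2-1 : ∀ i j x y → ë i x ≡ just y → Far i j → ε̈ j x ≡ ε̈ j y
      LQ2-2 : ∀ i j x y → ë i x ≡ just y → Next i j →
                ((ε̈ j x ≢ ε̈ j y) → (ε̈ j x ≡ ∞⁺ × ε̈ i y ≡ fin (+ 0)))
              × ((ε̈ j x ≡ ∞⁺ × ε̈ i y ≡ fin (+ 0)) → (ε̈ j x ≢ ε̈ j y))
              × ((ε̈ j x ≢ ε̈ j y) → ε̈ j y ≢ fin (+ 0))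
      LQ2-3 : ∀ i j x y → ë i x ≡ just y → Next j i →
                ((φ̈ j x ≢ φ̈ j y) → (φ̈ j y ≡ ∞⁺ × φ̈ i x ≡ fin (+ 0)))
              × ((φ̈ j y ≡ ∞⁺ × φ̈ i x ≡ fin (+ 0)) → (φ̈ j x ≢ φ̈ j y))
              × ((φ̈ j x ≢ φ̈ j y) → φ̈ j x ≢ fin (+ 0))
      LQ3 : ∀ i j x → i ≢ j → ë i x ≢ nothing → ë j x ≢ nothing →
              ((ë j x >>= ë i) ≡ (ë i x >>= ë j)) × ((ë j x >>= ë i) ≢ nothing)
      LQ3′ : ∀ i j x → i ≢ j → f̈ i x ≢ nothing → f̈ j x ≢ nothing →
              ((f̈ j x >>= f̈ i) ≡ (f̈ i x >>= f̈ j)) × ((f̈ j x >>= f̈ i) ≢ nothing)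

_⊗̈_ : {n : ℕ} → QData n → QData n → QData n
_⊗̈_ {n} Q Q′ = record
  { Carrier = Carrier Q × Carrier Q′
  ; ë = λ i p → let x = proj₁′ p ; x′ = proj₂′ p in
      if blocked i x x′ then nothing
      else (if ε̈ Q′ i x′ ≤ᵇ φ̈ Q i x
            then map (λ z → (z , x′)) (ë Q i x)
            else map (λ z → (x , z)) (ë Q′ i x′))
  ; f̈ = λ i p → let x = proj₁′ p ; x′ = proj₂′ p in
      if blocked i x x′ then nothing
      else (if ε̈ Q′ i x′ <ᵇ φ̈ Q i x
            then map (λ z → (z , x′)) (f̈ Q i x)
            else map (λ z → (x , z)) (f̈ Q′ i x′))
  ; ε̈ = λ i p → let x = proj₁′ p ; x′ = proj₂′ p in
      if blocked i x x′ then ∞⁺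
      else max∞ (ε̈ Q i x) (ε̈ Q′ i x′ ⊕ (- ⟨ wt Q x , α n i ⟩))
  ; φ̈ = λ i p → let x = proj₁′ p ; x′ = proj₂′ p in
      if blocked i x x′ then ∞⁺
      else max∞ (φ̈ Q i x ⊕ ⟨ wt Q′ x′ , α n i ⟩) (φ̈ Q′ i x′)
  ; wt = λ p → wt Q (proj₁′ p) +ᵥ wt Q′ (proj₂′ p)
  }
  where
  open QData
  proj₁′ : Carrier Q × Carrier Q′ → Carrier Q
  proj₁′ (a , _) = a
  proj₂′ : Carrier Q × Carrier Q′ → Carrier Q′
  proj₂′ (_ , b) = b
  blocked : Fin (pred n) → Carrier Q → Carrier Q′ → Bool
  blocked i x x′ = (fin (+ 0) <ᵇ φ̈ Q i x) ∧ (fin (+ 0) <ᵇ ε̈ Q′ i x′)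

{-# OPTIONS --safe #-}
-- Fix a colour i and write a, b for ε̈ᵢ, φ̈ᵢ of x and a′, b′ for those of x′.  In a seminormal
-- quasi-crystal ε̈ᵢ and φ̈ᵢ are both natural numbers or both +∞, and the tensor rule then has
-- three regimes: if a factor is infinite, or b > 0 and a′ > 0, then x ⊗̈ x′ has ε̈ᵢ = φ̈ᵢ = +∞ and
-- no i-arrows; if b = 0 then ε̈ᵢ = a + a′ and φ̈ᵢ = b′; if a′ = 0 then ε̈ᵢ = a and φ̈ᵢ = b + b′;
-- and ëᵢ, f̈ᵢ act on exactly one factor.  Every local axiom for x ⊗̈ x′ thus reduces, by a case
-- analysis on the regimes for the neighbouring colour j, to the same axiom for the factor that
-- moves.  Two further inputs are needed: along an i-step the weight pairing with αⱼ changes by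
-- ⟨αᵢ, αⱼ⟩ ∈ {0, -1}, so when ε̈ⱼ stays put φ̈ⱼ drops by one (and dually); and for LQ3, an i-step
-- in one factor and a j-step in the other leave each other's regime intact, by LQ1 and LQ2.
module Submission where

open import Defs
open import Data.Nat as ℕ using (ℕ; zero; suc; pred; _≤_; _<_)
import Data.Nat.Properties as ℕP
open import Data.Integer as ℤ using (ℤ; +_; -_; _+_; _*_; _-_)
import Data.Integer.Properties as ℤP
open import Data.Integer.Tactic.RingSolver using (solve-∀)
open import Data.Fin as Fin using (Fin; toℕ; inject₁)
open import Data.Fin.Properties using (toℕ-inject₁; toℕ-injective)
open import Data.Vec using (Vec; []; _∷_; lookup; tabulate)
open import Data.Vec.Properties using (lookup-zipWith; lookup∘tabulate)
open import Data.Bool using (true; false; if_then_else_)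
open import Data.Bool.Properties using (∧-zeroʳ)
open import Data.Maybe using (Maybe; just; nothing; map; _>>=_)
open import Data.Maybe.Properties using (map-just)
open import Data.Product using (_×_; _,_; proj₁; proj₂; ∃)
open import Data.Sum using (_⊎_; inj₁; inj₂; swap)
open import Data.Empty using (⊥-elim)
open import Function using (_∘_; mk⇔)
open import Relation.Nullary using (¬_; Dec; yes; no; does)
open import Relation.Nullary.Decidable using (dec-true; dec-false; does-⇔)
open import Relation.Binary.PropositionalEquality
open import Relation.Binary.Definitions using (tri<; tri≈; tri>)

fin-injective : ∀ {a b} → fin a ≡ fin b → a ≡ b
fin-injective refl = refl

fin-+-injective : ∀ {m k} → fin (+ m) ≡ fin (+ k) → m ≡ k
fin-+-injective refl = refl

≡fin⇒≢∞⁺ : ∀ {E a} → E ≡ fin a → E ≢ ∞⁺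
≡fin⇒≢∞⁺ refl ()

≡0⇒≢suc : ∀ {E k} → E ≡ fin (+ 0) → E ≢ fin (+ suc k)
≡0⇒≢suc refl ()

_≟∞_ : (a b : ℤ∞) → Dec (a ≡ b)
fin a ≟∞ fin b with a ℤ.≟ b
... | yes refl = yes refl
... | no a≢b = no (a≢b ∘ fin-injective)
fin _ ≟∞ ∞⁺ = no (λ ())
fin _ ≟∞ ∞⁻ = no (λ ())
∞⁺ ≟∞ fin _ = no (λ ())
∞⁺ ≟∞ ∞⁺ = yes refl
∞⁺ ≟∞ ∞⁻ = no (λ ())
∞⁻ ≟∞ fin _ = no (λ ())
∞⁻ ≟∞ ∞⁺ = no (λ ())
∞⁻ ≟∞ ∞⁻ = yes refl

just≢nothing : ∀ {A : Set} {a : A} → just a ≢ nothing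
just≢nothing ()

≢nothing⇒just : ∀ {A : Set} {ma : Maybe A} → ma ≢ nothing → ∃ λ a → ma ≡ just a
≢nothing⇒just {ma = just a} _ = a , refl
≢nothing⇒just {ma = nothing} ma≢nothing = ⊥-elim (ma≢nothing refl)

map≡just⇒ : ∀ {A B : Set} (f : A → B) {ma : Maybe A} {b} →
            map f ma ≡ just b → ∃ λ a → ma ≡ just a × f a ≡ b
map≡just⇒ f {just a} refl = a , refl , refl

max∞-fin-≤ : ∀ {a b} → a ℤ.≤ b → max∞ (fin a) (fin b) ≡ fin b
max∞-fin-≤ {a} {b} a≤b rewrite dec-true (a ℤ.≤? b) a≤b = refl

max∞-fin-≥ : ∀ {a b} → b ℤ.≤ a → max∞ (fin a) (fin b) ≡ fin a
max∞-fin-≥ {a} {b} b≤a with a ℤ.≤? b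
... | yes a≤b = cong fin (ℤP.≤-antisym b≤a a≤b)
... | no _ = refl

δ : ℕ → ℕ → ℤ
δ a b = if does (a ℕ.≟ b) then + 1 else + 0

δ-refl : ∀ a → δ a a ≡ + 1
δ-refl a rewrite dec-true (a ℕ.≟ a) refl = refl

δ-≢ : ∀ {a b} → a ≢ b → δ a b ≡ + 0
δ-≢ {a} {b} a≢b rewrite dec-false (a ℕ.≟ b) a≢b = refl

cartan : ℕ → ℕ → ℤ
cartan i j = (δ j i - δ j (suc i)) - (δ (suc j) i - δ (suc j) (suc i))

cartan-far : ∀ i j → suc i < j ⊎ suc j < i → cartan i j ≡ + 0
cartan-far i j (inj₁ 1+i<j)
  rewrite δ-≢ (ℕP.>⇒≢ (ℕP.<-trans (ℕP.n<1+n i) 1+i<j))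
        | δ-≢ (ℕP.>⇒≢ 1+i<j)
        | δ-≢ (ℕP.>⇒≢ (ℕP.<-trans (ℕP.n<1+n i) (ℕP.m<n⇒m<1+n 1+i<j))) = refl
cartan-far i j (inj₂ 1+j<i)
  rewrite δ-≢ (ℕP.<⇒≢ (ℕP.<-trans (ℕP.n<1+n j) 1+j<i))
        | δ-≢ (ℕP.<⇒≢ (ℕP.m<n⇒m<1+n (ℕP.<-trans (ℕP.n<1+n j) 1+j<i)))
        | δ-≢ (ℕP.<⇒≢ 1+j<i) = refl

cartan-next : ∀ i → cartan i (suc i) ≡ - + 1
cartan-next i
  rewrite δ-≢ (ℕP.1+n≢n {i}) | δ-refl i | δ-≢ (ℕP.>⇒≢ (ℕP.m<n⇒m<1+n (ℕP.n<1+n i))) = refl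

cartan-prev : ∀ j → cartan (suc j) j ≡ - + 1
cartan-prev j
  rewrite δ-≢ (ℕP.<⇒≢ (ℕP.n<1+n j)) | δ-refl j | δ-≢ (ℕP.<⇒≢ (ℕP.m<n⇒m<1+n (ℕP.n<1+n j))) = refl

cartan-adjacent : ∀ {i j} → j ≡ suc i ⊎ i ≡ suc j → cartan i j ≡ - + 1
cartan-adjacent {i} (inj₁ refl) = cartan-next i
cartan-adjacent {j = j} (inj₂ refl) = cartan-prev j

⟨⟩-distribˡ-+ᵥ : ∀ {m} (u v w : Vec ℤ m) → ⟨ u +ᵥ v , w ⟩ ≡ ⟨ u , w ⟩ + ⟨ v , w ⟩
⟨⟩-distribˡ-+ᵥ [] [] [] = refl
⟨⟩-distribˡ-+ᵥ (a ∷ u) (b ∷ v) (c ∷ w) =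
  trans (cong (λ s → (a + b) * c + s) (⟨⟩-distribˡ-+ᵥ u v w)) (distrib a b c _ _)
  where
  distrib : ∀ a b c s t → (a + b) * c + (s + t) ≡ (a * c + s) + (b * c + t)
  distrib = solve-∀

⟨⟩-distribʳ--ᵥ : ∀ {m} (u v w : Vec ℤ m) → ⟨ u , v -ᵥ w ⟩ ≡ ⟨ u , v ⟩ - ⟨ u , w ⟩
⟨⟩-distribʳ--ᵥ [] [] [] = refl
⟨⟩-distribʳ--ᵥ (a ∷ u) (b ∷ v) (c ∷ w) =
  trans (cong (λ s → a * (b - c) + s) (⟨⟩-distribʳ--ᵥ u v w)) (distrib a b c _ _)
  where
  distrib : ∀ a b c s t → a * (b - c) + (s - t) ≡ (a * b + s) - (a * c + t)
  distrib = solve-∀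

⟨⟩-zeroʳ : ∀ {m} (v : Vec ℤ m) → ⟨ v , tabulate (λ _ → + 0) ⟩ ≡ + 0
⟨⟩-zeroʳ [] = refl
⟨⟩-zeroʳ (a ∷ v) = trans (cong (λ s → a * + 0 + s) (⟨⟩-zeroʳ v)) (annihilate a)
  where
  annihilate : ∀ a → a * + 0 + + 0 ≡ + 0
  annihilate = solve-∀

⟨⟩-𝐞 : ∀ {m} (v : Vec ℤ m) (k : Fin m) → ⟨ v , 𝐞 k ⟩ ≡ lookup v k
⟨⟩-𝐞 (a ∷ v) Fin.zero = trans (cong (λ s → a * + 1 + s) (⟨⟩-zeroʳ v)) (unit a)
  where
  unit : ∀ a → a * + 1 + + 0 ≡ a
  unit = solve-∀
⟨⟩-𝐞 (a ∷ v) (Fin.suc k) = trans (absorb a _) (⟨⟩-𝐞 v k)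
  where
  absorb : ∀ a s → a * + 0 + s ≡ s
  absorb = solve-∀

lookup-𝐞 : ∀ {m} (q p : Fin m) → lookup (𝐞 q) p ≡ δ (toℕ p) (toℕ q)
lookup-𝐞 q p = trans (lookup∘tabulate _ p)
  (cong (if_then + 1 else + 0) (does-⇔ (mk⇔ (cong toℕ) toℕ-injective) (p Fin.≟ q) (toℕ p ℕ.≟ toℕ q)))

lookup-α : ∀ m (i : Fin m) (p : Fin (suc m)) →
           lookup (α (suc m) i) p ≡ δ (toℕ p) (toℕ i) - δ (toℕ p) (suc (toℕ i))
lookup-α m i p = begin
  lookup (α (suc m) i) p
    ≡⟨ lookup-zipWith _-_ p (𝐞 (inject₁ i)) (𝐞 (Fin.suc i)) ⟩
  lookup (𝐞 (inject₁ i)) p - lookup (𝐞 (Fin.suc i)) p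
    ≡⟨ cong₂ _-_ (lookup-𝐞 _ p) (lookup-𝐞 _ p) ⟩
  δ (toℕ p) (toℕ (inject₁ i)) - δ (toℕ p) (suc (toℕ i))
    ≡⟨ cong (λ k → δ (toℕ p) k - δ (toℕ p) (suc (toℕ i))) (toℕ-inject₁ i) ⟩
  δ (toℕ p) (toℕ i) - δ (toℕ p) (suc (toℕ i)) ∎
  where open ≡-Reasoning

⟨α,α⟩≡cartan : ∀ n (i j : Fin (pred n)) → ⟨ α n i , α n j ⟩ ≡ cartan (toℕ i) (toℕ j)
⟨α,α⟩≡cartan (suc m) i j = begin
  ⟨ α (suc m) i , α (suc m) j ⟩
    ≡⟨ ⟨⟩-distribʳ--ᵥ (α (suc m) i) (𝐞 (inject₁ j)) (𝐞 (Fin.suc j)) ⟩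
  ⟨ α (suc m) i , 𝐞 (inject₁ j) ⟩ - ⟨ α (suc m) i , 𝐞 (Fin.suc j) ⟩
    ≡⟨ cong₂ _-_ (⟨⟩-𝐞 (α (suc m) i) (inject₁ j)) (⟨⟩-𝐞 (α (suc m) i) (Fin.suc j)) ⟩
  lookup (α (suc m) i) (inject₁ j) - lookup (α (suc m) i) (Fin.suc j)
    ≡⟨ cong₂ _-_ (lookup-α m i (inject₁ j)) (lookup-α m i (Fin.suc j)) ⟩
  (δ (toℕ (inject₁ j)) (toℕ i) - δ (toℕ (inject₁ j)) (suc (toℕ i))) - Δ
    ≡⟨ cong (λ k → (δ k (toℕ i) - δ k (suc (toℕ i))) - Δ) (toℕ-inject₁ j) ⟩
  cartan (toℕ i) (toℕ j) ∎
  where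
  open ≡-Reasoning
  Δ = δ (suc (toℕ j)) (toℕ i) - δ (suc (toℕ j)) (suc (toℕ i))

drop-by-one : ∀ {a b d} → + d - + a ≡ (+ b - + a) - + 1 → b ≡ suc d
drop-by-one {a} {b} {d} eq = sym (ℤP.+-injective (begin
  + suc d                              ≡⟨ ℤP.pos-+ 1 d ⟩
  + 1 + + d                            ≡⟨ regroup (+ a) (+ d) ⟩
  (+ d - + a) + + a + + 1              ≡⟨ cong (λ t → t + + a + + 1) eq ⟩
  ((+ b - + a) - + 1) + + a + + 1      ≡⟨ cancel (+ a) (+ b) ⟩
  + b                                  ∎))
  where
  open ≡-Reasoning
  regroup : ∀ a d → + 1 + d ≡ (d - a) + a + + 1
  regroup = solve-∀
  cancel : ∀ a b → ((b - a) - + 1) + a + + 1 ≡ b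
  cancel = solve-∀

rise-by-one : ∀ {a b c} → + b - + c ≡ (+ b - + a) - + 1 → c ≡ suc a
rise-by-one {a} {b} {c} eq = ℤP.+-injective (begin
  + c                                  ≡⟨ regroup (+ b) (+ c) ⟩
  + b - (+ b - + c)                    ≡⟨ cong (λ t → + b - t) eq ⟩
  + b - ((+ b - + a) - + 1)            ≡⟨ cancel (+ a) (+ b) ⟩
  + 1 + + a                            ≡⟨ sym (ℤP.pos-+ 1 a) ⟩
  + suc a                              ∎)
  where
  open ≡-Reasoning
  regroup : ∀ b c → c ≡ b - (b - c)
  regroup = solve-∀
  cancel : ∀ a b → b - ((b - a) - + 1) ≡ + 1 + a
  cancel = solve-∀

Commute : {A : Set} → (A → Maybe A) → (A → Maybe A) → A → Set
Commute f g x = ((g x >>= f) ≡ (f x >>= g)) × ((g x >>= f) ≢ nothing)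

Commute⇒square : ∀ {A : Set} (f g : A → Maybe A) {x y z} → Commute f g x →
                 f x ≡ just y → g x ≡ just z → ∃ λ w → g y ≡ just w × f z ≡ just w
Commute⇒square f g {z = z} (fz≡gy , fz≢nothing) fx gx rewrite fx | gx with f z
... | just w = w , sym fz≡gy , refl
... | nothing = ⊥-elim (fz≢nothing refl)

square⇒Commute : ∀ {A : Set} (f g : A → Maybe A) {x y z w} →
                 f x ≡ just y → g x ≡ just z → g y ≡ just w → f z ≡ just w → Commute f g x
square⇒Commute f g fx gx gy fz rewrite fx | gx | gy | fz = refl , λ ()

-- In a seminormal quasi-crystal, LQ2-2 for an i-step x ↦ y says exactly
-- Change (ε̈ⱼ x) (ε̈ⱼ y) (ε̈ᵢ y), and LQ2-3 says Change (φ̈ⱼ y) (φ̈ⱼ x) (φ̈ᵢ x).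
data Change (E E′ Z : ℤ∞) : Set where
  unchanged      : E ≡ E′ → ¬ (E ≡ ∞⁺ × Z ≡ fin (+ 0)) → Change E E′ Z
  becomes-finite : (m : ℕ) → E ≡ ∞⁺ → Z ≡ fin (+ 0) → E′ ≡ fin (+ m) → m ≢ 0 → Change E E′ Z

Change-preserves-0 : ∀ {E E′ Z} → Change E E′ Z → E ≡ fin (+ 0) → E′ ≡ fin (+ 0)
Change-preserves-0 (unchanged same _) E0 = trans (sym same) E0
Change-preserves-0 (becomes-finite _ E∞ _ _ _) E0 = ⊥-elim (≡fin⇒≢∞⁺ E0 E∞)

Change-reflects-0 : ∀ {E E′ Z} → Change E E′ Z → E′ ≡ fin (+ 0) → E ≡ fin (+ 0)
Change-reflects-0 (unchanged same _) E′0 = trans same E′0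
Change-reflects-0 (becomes-finite _ _ _ E′m m≢0) E′0 = ⊥-elim (m≢0 (fin-+-injective (trans (sym E′m) E′0)))

Change⇒LQ2-2 : ∀ {E E′ Z} → Change E E′ Z →
                 ((E ≢ E′) → (E ≡ ∞⁺ × Z ≡ fin (+ 0)))
               × ((E ≡ ∞⁺ × Z ≡ fin (+ 0)) → (E ≢ E′))
               × ((E ≢ E′) → E′ ≢ fin (+ 0))
Change⇒LQ2-2 (unchanged same no-jump) =
  (λ differ → ⊥-elim (differ same)) , (λ jump _ → no-jump jump) , (λ differ → ⊥-elim (differ same))
Change⇒LQ2-2 (becomes-finite m E∞ Z0 E′m m≢0) =
  (λ _ → E∞ , Z0) ,
  (λ _ same → ≡fin⇒≢∞⁺ E′m (trans (sym same) E∞)) ,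
  (λ _ E′0 → m≢0 (fin-+-injective (trans (sym E′m) E′0)))

Change⇒LQ2-3 : ∀ {E E′ Z} → Change E′ E Z →
                 ((E ≢ E′) → (E′ ≡ ∞⁺ × Z ≡ fin (+ 0)))
               × ((E′ ≡ ∞⁺ × Z ≡ fin (+ 0)) → (E ≢ E′))
               × ((E ≢ E′) → E ≢ fin (+ 0))
Change⇒LQ2-3 change with Change⇒LQ2-2 change
... | jumps , jump⇒differ , nonzero = jumps ∘ ≢-sym , ≢-sym ∘ jump⇒differ , nonzero ∘ ≢-sym

module Strings {n : ℕ} (Q : QData n) (qc : IsQuasiCrystal Q) (qs : IsSeminormal Q) where
  open QData Q
  open IsQuasiCrystal qc

  data String (i : Fin (pred n)) (x : Carrier) : Set where
    finite   : (a b : ℕ) → ε̈ i x ≡ fin (+ a) → φ̈ i x ≡ fin (+ b) → String i x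
    infinite : ε̈ i x ≡ ∞⁺ → φ̈ i x ≡ ∞⁺ → String i x

  ε∞⇒φ∞ : ∀ i x → ε̈ i x ≡ ∞⁺ → φ̈ i x ≡ ∞⁺
  ε∞⇒φ∞ i x ε∞ = trans (Q2 i x) (cong (_⊕ ⟨ wt x , α n i ⟩) ε∞)

  string : ∀ i x → String i x
  string i x with ε̈ i x ≟∞ ∞⁺
  ... | yes ε∞ = infinite ε∞ (ε∞⇒φ∞ i x ε∞)
  ... | no ε≢∞ with qs i x ε≢∞
  ... | (a , _ , εa) , (b , _ , φb) = finite a b εa φb

  φ∞⇒ε∞ : ∀ i x → φ̈ i x ≡ ∞⁺ → ε̈ i x ≡ ∞⁺
  φ∞⇒ε∞ i x φ∞ with string i x
  ... | infinite ε∞ _ = ε∞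
  ... | finite _ _ _ φb = ⊥-elim (≡fin⇒≢∞⁺ φb φ∞)

  ε-fin⇒φ-fin : ∀ i x {a} → ε̈ i x ≡ fin (+ a) → ∃ λ b → φ̈ i x ≡ fin (+ b)
  ε-fin⇒φ-fin i x εa with string i x
  ... | finite _ b _ φb = b , φb
  ... | infinite ε∞ _ = ⊥-elim (≡fin⇒≢∞⁺ εa ε∞)

  φ-fin⇒ε-fin : ∀ i x {b} → φ̈ i x ≡ fin (+ b) → ∃ λ a → ε̈ i x ≡ fin (+ a)
  φ-fin⇒ε-fin i x φb with string i x
  ... | finite a _ εa _ = a , εa
  ... | infinite _ φ∞ = ⊥-elim (≡fin⇒≢∞⁺ φb φ∞)

  ⟨wt,α⟩≡φ-ε : ∀ i x {a b} → ε̈ i x ≡ fin (+ a) → φ̈ i x ≡ fin (+ b) → ⟨ wt x , α n i ⟩ ≡ + b - + a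
  ⟨wt,α⟩≡φ-ε i x {a} {b} εa φb = begin
    w                   ≡⟨ cancel (+ a) w ⟩
    (+ a + w) - + a     ≡⟨ cong (_- + a) (fin-injective (sym (trans (sym φb) (trans (Q2 i x) (cong (_⊕ w) εa))))) ⟩
    + b - + a           ∎
    where
    open ≡-Reasoning
    w = ⟨ wt x , α n i ⟩
    cancel : ∀ a w → w ≡ (a + w) - a
    cancel = solve-∀

  ë-defined⇒ε≢0 : ∀ {i x y} → ë i x ≡ just y → ε̈ i x ≢ fin (+ 0)
  ë-defined⇒ε≢0 {i} {x} step with ε̈ i x ≟∞ ∞⁺
  ... | yes ε∞ = λ ε0 → ≡fin⇒≢∞⁺ ε0 ε∞
  ... | no ε≢∞ with proj₁ (qs i x ε≢∞)
  ... | k , (_ , maximal) , εk = λ ε0 → ℕP.1+n≰n (subst (1 ℕ.≤_) (fin-+-injective (trans (sym εk) ε0))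
                                                      (maximal 1 (just≢nothing ∘ trans (sym step))))

  f̈-defined⇒φ≢0 : ∀ {i x y} → f̈ i x ≡ just y → φ̈ i x ≢ fin (+ 0)
  f̈-defined⇒φ≢0 {i} {x} step with ε̈ i x ≟∞ ∞⁺
  ... | yes ε∞ = λ φ0 → ≡fin⇒≢∞⁺ φ0 (ε∞⇒φ∞ i x ε∞)
  ... | no ε≢∞ with proj₂ (qs i x ε≢∞)
  ... | k , (_ , maximal) , φk = λ φ0 → ℕP.1+n≰n (subst (1 ℕ.≤_) (fin-+-injective (trans (sym φk) φ0))
                                                      (maximal 1 (just≢nothing ∘ trans (sym step))))

  ⟨wt,α⟩-step : ∀ {i x y} j → ë i x ≡ just y →
                ⟨ wt y , α n j ⟩ ≡ ⟨ wt x , α n j ⟩ + cartan (toℕ i) (toℕ j)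
  ⟨wt,α⟩-step {i} {x} {y} j step = begin
    ⟨ wt y , α n j ⟩                           ≡⟨ cong ⟨_, α n j ⟩ (Q1-wt i x y step) ⟩
    ⟨ wt x +ᵥ α n i , α n j ⟩                  ≡⟨ ⟨⟩-distribˡ-+ᵥ (wt x) (α n i) (α n j) ⟩
    ⟨ wt x , α n j ⟩ + ⟨ α n i , α n j ⟩       ≡⟨ cong (λ t → ⟨ wt x , α n j ⟩ + t) (⟨α,α⟩≡cartan n i j) ⟩
    ⟨ wt x , α n j ⟩ + cartan (toℕ i) (toℕ j)  ∎
    where open ≡-Reasoning

  ⟨wt,α⟩-far : ∀ {i x y} j → ë i x ≡ just y → Far Q i j → ⟨ wt y , α n j ⟩ ≡ ⟨ wt x , α n j ⟩
  ⟨wt,α⟩-far {i} {x} j step far = begin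
    ⟨ wt _ , α n j ⟩                           ≡⟨ ⟨wt,α⟩-step j step ⟩
    ⟨ wt x , α n j ⟩ + cartan (toℕ i) (toℕ j)  ≡⟨ cong (λ t → ⟨ wt x , α n j ⟩ + t) (cartan-far (toℕ i) (toℕ j) far) ⟩
    ⟨ wt x , α n j ⟩ + + 0                     ≡⟨ ℤP.+-identityʳ _ ⟩
    ⟨ wt x , α n j ⟩                           ∎
    where open ≡-Reasoning

  ε-fixed⇒φ-drops : ∀ {i j x y a b} → ë i x ≡ just y → Next Q i j ⊎ Next Q j i →
                    ε̈ j x ≡ fin (+ a) → φ̈ j x ≡ fin (+ b) → ε̈ j y ≡ fin (+ a) →
                    ∃ λ d → b ≡ suc d × φ̈ j y ≡ fin (+ d)
  ε-fixed⇒φ-drops {i} {j} {x} {y} {a} {b} step adjacent εx φx εy with ε-fin⇒φ-fin j y εy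
  ... | d , φy = d , drop-by-one {a} (begin
    + d - + a                                   ≡⟨ sym (⟨wt,α⟩≡φ-ε j y εy φy) ⟩
    ⟨ wt y , α n j ⟩                            ≡⟨ ⟨wt,α⟩-step j step ⟩
    ⟨ wt x , α n j ⟩ + cartan (toℕ i) (toℕ j)   ≡⟨ cong₂ _+_ (⟨wt,α⟩≡φ-ε j x εx φx) (cartan-adjacent adjacent) ⟩
    (+ b - + a) - + 1                           ∎) , φy
    where open ≡-Reasoning

  φ-fixed⇒ε-rises : ∀ {i j x y a b} → ë i x ≡ just y → Next Q i j ⊎ Next Q j i →
                    ε̈ j x ≡ fin (+ a) → φ̈ j x ≡ fin (+ b) → φ̈ j y ≡ fin (+ b) →
                    ε̈ j y ≡ fin (+ suc a)
  φ-fixed⇒ε-rises {i} {j} {x} {y} {a} {b} step adjacent εx φx φy with φ-fin⇒ε-fin j y φy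
  ... | c , εy = trans εy (cong (λ k → fin (+ k)) (rise-by-one (begin
    + b - + c                                   ≡⟨ sym (⟨wt,α⟩≡φ-ε j y εy φy) ⟩
    ⟨ wt y , α n j ⟩                            ≡⟨ ⟨wt,α⟩-step j step ⟩
    ⟨ wt x , α n j ⟩ + cartan (toℕ i) (toℕ j)   ≡⟨ cong₂ _+_ (⟨wt,α⟩≡φ-ε j x εx φx) (cartan-adjacent adjacent) ⟩
    (+ b - + a) - + 1                           ∎)))
    where open ≡-Reasoning

module LocalFacts {n : ℕ} (Q : QData n) (qc : IsQuasiCrystal Q) (qs : IsSeminormal Q) (la : LocalAxioms Q) where
  open QData Q
  open IsQuasiCrystal qc
  open LocalAxioms la
  open Strings Q qc qs

  εᵢ≡0⇒φⱼ≡0 : ∀ {i j} x → Next Q i j → ε̈ i x ≡ fin (+ 0) → φ̈ j x ≡ fin (+ 0)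
  εᵢ≡0⇒φⱼ≡0 {i} {j} x next = proj₁ (LQ1 i j x next)

  φⱼ≡0⇒εᵢ≡0 : ∀ {i j} x → Next Q i j → φ̈ j x ≡ fin (+ 0) → ε̈ i x ≡ fin (+ 0)
  φⱼ≡0⇒εᵢ≡0 {i} {j} x next = proj₂ (LQ1 i j x next)

  ε-far : ∀ {i j x y} → ë i x ≡ just y → Far Q i j → ε̈ j x ≡ ε̈ j y
  ε-far {i} {j} {x} {y} step far = LQ2-1 i j x y step far

  φ-far : ∀ {i j x y} → ë i x ≡ just y → Far Q i j → φ̈ j y ≡ φ̈ j x
  φ-far {i} {j} {x} {y} step far = begin
    φ̈ j y                          ≡⟨ Q2 j y ⟩
    ε̈ j y ⊕ ⟨ wt y , α n j ⟩        ≡⟨ cong₂ _⊕_ (sym (ε-far step far)) (⟨wt,α⟩-far j step far) ⟩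
    ε̈ j x ⊕ ⟨ wt x , α n j ⟩        ≡⟨ sym (Q2 j x) ⟩
    φ̈ j x                          ∎
    where open ≡-Reasoning

  ε-change : ∀ {i j x y} → ë i x ≡ just y → Next Q i j → Change (ε̈ j x) (ε̈ j y) (ε̈ i y)
  ε-change {i} {j} {x} {y} step next with ε̈ j x ≟∞ ε̈ j y | LQ2-2 i j x y step next
  ... | yes same | _ , no-jump , _ = unchanged same (λ jump → no-jump jump same)
  ... | no differ | jumps , _ , nonzero with jumps differ | string j y
  ...   | ε∞ , z | finite m _ εm _ =
          becomes-finite m ε∞ z εm (nonzero differ ∘ trans εm ∘ cong (λ k → fin (+ k)))
  ...   | ε∞ , _ | infinite εy∞ _ = ⊥-elim (differ (trans ε∞ (sym εy∞)))

  φ-change : ∀ {i j x y} → ë i x ≡ just y → Next Q j i → Change (φ̈ j y) (φ̈ j x) (φ̈ i x)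
  φ-change {i} {j} {x} {y} step next with φ̈ j y ≟∞ φ̈ j x | LQ2-3 i j x y step next
  ... | yes same | _ , no-jump , _ = unchanged same (λ jump → no-jump jump (sym same))
  ... | no differ | jumps , _ , nonzero with jumps (≢-sym differ) | string j x
  ...   | φ∞ , z | finite _ m _ φm =
          becomes-finite m φ∞ z φm (nonzero (≢-sym differ) ∘ trans φm ∘ cong (λ k → fin (+ k)))
  ...   | φ∞ , _ | infinite _ φx∞ = ⊥-elim (differ (trans φ∞ (sym φx∞)))

  ë-square : ∀ {i j x y z} → i ≢ j → ë i x ≡ just y → ë j x ≡ just z →
             ∃ λ w → ë j y ≡ just w × ë i z ≡ just w
  ë-square {i} {j} i≢j stepᵢ stepⱼ =
    Commute⇒square (ë i) (ë j)
      (LQ3 i j _ i≢j (just≢nothing ∘ trans (sym stepᵢ)) (just≢nothing ∘ trans (sym stepⱼ))) stepᵢ stepⱼ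

  f̈-square : ∀ {i j x y z} → i ≢ j → f̈ i x ≡ just y → f̈ j x ≡ just z →
             ∃ λ w → f̈ j y ≡ just w × f̈ i z ≡ just w
  f̈-square {i} {j} i≢j stepᵢ stepⱼ =
    Commute⇒square (f̈ i) (f̈ j)
      (LQ3′ i j _ i≢j (just≢nothing ∘ trans (sym stepᵢ)) (just≢nothing ∘ trans (sym stepⱼ))) stepᵢ stepⱼ

module Tensor {n : ℕ} (Q Q′ : QData n) (qc : IsQuasiCrystal Q) (qs : IsSeminormal Q)
              (qc′ : IsQuasiCrystal Q′) (qs′ : IsSeminormal Q′) where
  open QData
  module S = Strings Q qc qs
  module S′ = Strings Q′ qc′ qs′

  Q⊗Q′ : QData n
  Q⊗Q′ = Q ⊗̈ Q′

  ⊗-infiniteˡ : ∀ i x x′ → ε̈ Q i x ≡ ∞⁺ → ε̈ Q⊗Q′ i (x , x′) ≡ ∞⁺ × φ̈ Q⊗Q′ i (x , x′) ≡ ∞⁺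
  ⊗-infiniteˡ i x x′ ε∞ with S′.string i x′
  ... | S′.infinite ε′∞ _ rewrite ε∞ | S.ε∞⇒φ∞ i x ε∞ | ε′∞ = refl , refl
  ... | S′.finite zero _ ε′0 φ′ rewrite ε∞ | S.ε∞⇒φ∞ i x ε∞ | ε′0 | φ′ = refl , refl
  ... | S′.finite (suc _) _ ε′ _ rewrite ε∞ | S.ε∞⇒φ∞ i x ε∞ | ε′ = refl , refl

  ⊗-infiniteʳ : ∀ i x x′ → ε̈ Q′ i x′ ≡ ∞⁺ → ε̈ Q⊗Q′ i (x , x′) ≡ ∞⁺ × φ̈ Q⊗Q′ i (x , x′) ≡ ∞⁺
  ⊗-infiniteʳ i x x′ ε′∞ with S.string i x
  ... | S.infinite _ φ∞ rewrite φ∞ | ε′∞ = refl , refl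
  ... | S.finite _ zero ε φ0 rewrite ε | φ0 | ε′∞ | S′.ε∞⇒φ∞ i x′ ε′∞ = refl , refl
  ... | S.finite _ (suc _) _ φ rewrite φ | ε′∞ = refl , refl

  ⊗-blocked : ∀ i x x′ {b a′} → φ̈ Q i x ≡ fin (+ suc b) → ε̈ Q′ i x′ ≡ fin (+ suc a′) →
              ε̈ Q⊗Q′ i (x , x′) ≡ ∞⁺ × φ̈ Q⊗Q′ i (x , x′) ≡ ∞⁺
  ⊗-blocked i x x′ φ ε′ rewrite φ | ε′ = refl , refl

  ⊗-φˡ≡0 : ∀ i x x′ {a a′ b′} → ε̈ Q i x ≡ fin (+ a) → φ̈ Q i x ≡ fin (+ 0) →
           ε̈ Q′ i x′ ≡ fin (+ a′) → φ̈ Q′ i x′ ≡ fin (+ b′) →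
           ε̈ Q⊗Q′ i (x , x′) ≡ fin (+ (a ℕ.+ a′)) × φ̈ Q⊗Q′ i (x , x′) ≡ fin (+ b′)
  ⊗-φˡ≡0 i x x′ {a} {a′} {b′} ε φ0 ε′ φ′
    rewrite ε | φ0 | ε′ | φ′ | S.⟨wt,α⟩≡φ-ε i x ε φ0 | S′.⟨wt,α⟩≡φ-ε i x′ ε′ φ′ =
    trans (cong (λ t → max∞ (fin (+ a)) (fin t)) (regroup (+ a) (+ a′)))
          (trans (max∞-fin-≤ (ℤP.i≤i+j (+ a) (+ a′))) (cong fin (sym (ℤP.pos-+ a a′)))) ,
    max∞-fin-≤ (subst (ℤ._≤ + b′) (sym (ℤP.+-identityˡ _)) (ℤP.i-j≤i (+ b′) (+ a′)))
    where
    regroup : ∀ a a′ → a′ + - (+ 0 - a) ≡ a + a′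
    regroup = solve-∀

  ⊗-εʳ≡0 : ∀ i x x′ {a b b′} → ε̈ Q i x ≡ fin (+ a) → φ̈ Q i x ≡ fin (+ b) →
           ε̈ Q′ i x′ ≡ fin (+ 0) → φ̈ Q′ i x′ ≡ fin (+ b′) →
           ε̈ Q⊗Q′ i (x , x′) ≡ fin (+ a) × φ̈ Q⊗Q′ i (x , x′) ≡ fin (+ (b ℕ.+ b′))
  -- The blocking test φ̈ᵢ x > 0 ∧ ε̈ᵢ x′ > 0 is stuck on its left conjunct for a variable b.
  ⊗-εʳ≡0 i x x′ {a} {b} {b′} ε φ ε′0 φ′
    rewrite ε | φ | ε′0 | φ′ | S.⟨wt,α⟩≡φ-ε i x ε φ | S′.⟨wt,α⟩≡φ-ε i x′ ε′0 φ′
          | ∧-zeroʳ (if fin (+ b) ≤ᵇ fin (+ 0) then false else true) =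
    max∞-fin-≥ (subst (ℤ._≤ + a) (negate (+ a) (+ b)) (ℤP.i-j≤i (+ a) (+ b))) ,
    trans (cong (λ t → max∞ (fin t) (fin (+ b′))) (drop-zero (+ b) (+ b′)))
          (trans (max∞-fin-≥ (ℤP.i≤j+i (+ b′) (+ b))) (cong fin (sym (ℤP.pos-+ b b′))))
    where
    negate : ∀ a b → a - b ≡ + 0 + - (b - a)
    negate = solve-∀
    drop-zero : ∀ b b′ → b + (b′ - + 0) ≡ b + b′
    drop-zero = solve-∀

  ⊗-ε≡0⇒ : ∀ i x x′ → ε̈ Q⊗Q′ i (x , x′) ≡ fin (+ 0) → ε̈ Q i x ≡ fin (+ 0) × ε̈ Q′ i x′ ≡ fin (+ 0)
  ⊗-ε≡0⇒ i x x′ ε⊗0 with S.string i x | S′.string i x′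
  ... | S.infinite ε∞ _ | _ = ⊥-elim (≡fin⇒≢∞⁺ ε⊗0 (proj₁ (⊗-infiniteˡ i x x′ ε∞)))
  ... | S.finite _ _ _ _ | S′.infinite ε′∞ _ = ⊥-elim (≡fin⇒≢∞⁺ ε⊗0 (proj₁ (⊗-infiniteʳ i x x′ ε′∞)))
  ... | S.finite a zero ε φ0 | S′.finite a′ _ ε′ φ′
    with fin-+-injective (trans (sym (proj₁ (⊗-φˡ≡0 i x x′ ε φ0 ε′ φ′))) ε⊗0)
  ...   | a+a′≡0 = trans ε (cong (λ k → fin (+ k)) (ℕP.m+n≡0⇒m≡0 a a+a′≡0)) ,
                   trans ε′ (cong (λ k → fin (+ k)) (ℕP.m+n≡0⇒n≡0 a a+a′≡0))
  ⊗-ε≡0⇒ i x x′ ε⊗0 | S.finite a (suc _) ε φ | S′.finite zero _ ε′0 φ′ =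
    trans ε (trans (sym (proj₁ (⊗-εʳ≡0 i x x′ ε φ ε′0 φ′))) ε⊗0) , ε′0
  ⊗-ε≡0⇒ i x x′ ε⊗0 | S.finite _ (suc _) _ φ | S′.finite (suc _) _ ε′ _ =
    ⊥-elim (≡fin⇒≢∞⁺ ε⊗0 (proj₁ (⊗-blocked i x x′ φ ε′)))

  ⊗-φ≡0⇒ : ∀ i x x′ → φ̈ Q⊗Q′ i (x , x′) ≡ fin (+ 0) → φ̈ Q i x ≡ fin (+ 0) × φ̈ Q′ i x′ ≡ fin (+ 0)
  ⊗-φ≡0⇒ i x x′ φ⊗0 with S.string i x | S′.string i x′
  ... | S.infinite ε∞ _ | _ = ⊥-elim (≡fin⇒≢∞⁺ φ⊗0 (proj₂ (⊗-infiniteˡ i x x′ ε∞)))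
  ... | S.finite _ _ _ _ | S′.infinite ε′∞ _ = ⊥-elim (≡fin⇒≢∞⁺ φ⊗0 (proj₂ (⊗-infiniteʳ i x x′ ε′∞)))
  ... | S.finite _ zero ε φ0 | S′.finite _ _ ε′ φ′ =
    φ0 , trans φ′ (trans (sym (proj₂ (⊗-φˡ≡0 i x x′ ε φ0 ε′ φ′))) φ⊗0)
  ... | S.finite _ (suc _) ε φ | S′.finite zero _ ε′0 φ′ =
    ⊥-elim (≡0⇒≢suc φ⊗0 (proj₂ (⊗-εʳ≡0 i x x′ ε φ ε′0 φ′)))
  ... | S.finite _ (suc _) _ φ | S′.finite (suc _) _ ε′ _ =
    ⊥-elim (≡fin⇒≢∞⁺ φ⊗0 (proj₂ (⊗-blocked i x x′ φ ε′)))

  ⊗-ε≡0⇐ : ∀ i x x′ → ε̈ Q i x ≡ fin (+ 0) → ε̈ Q′ i x′ ≡ fin (+ 0) → ε̈ Q⊗Q′ i (x , x′) ≡ fin (+ 0)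
  ⊗-ε≡0⇐ i x x′ ε0 ε′0 =
    proj₁ (⊗-εʳ≡0 i x x′ ε0 (proj₂ (S.ε-fin⇒φ-fin i x ε0)) ε′0 (proj₂ (S′.ε-fin⇒φ-fin i x′ ε′0)))

  ⊗-φ≡0⇐ : ∀ i x x′ → φ̈ Q i x ≡ fin (+ 0) → φ̈ Q′ i x′ ≡ fin (+ 0) → φ̈ Q⊗Q′ i (x , x′) ≡ fin (+ 0)
  ⊗-φ≡0⇐ i x x′ φ0 φ′0 =
    proj₂ (⊗-φˡ≡0 i x x′ (proj₂ (S.φ-fin⇒ε-fin i x φ0)) φ0 (proj₂ (S′.φ-fin⇒ε-fin i x′ φ′0)) φ′0)

  ë⊗-left : ∀ i x x′ → ε̈ Q′ i x′ ≡ fin (+ 0) → ë Q⊗Q′ i (x , x′) ≡ map (_, x′) (ë Q i x)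
  ë⊗-left i x x′ ε′0 with S.string i x
  ... | S.infinite _ φ∞ rewrite φ∞ | ε′0 = refl
  ... | S.finite _ b _ φ rewrite φ | ε′0 | ∧-zeroʳ (if fin (+ b) ≤ᵇ fin (+ 0) then false else true) = refl

  ë⊗-right : ∀ i x x′ → φ̈ Q i x ≡ fin (+ 0) → ε̈ Q′ i x′ ≢ fin (+ 0) → ë Q⊗Q′ i (x , x′) ≡ map (x ,_) (ë Q′ i x′)
  ë⊗-right i x x′ φ0 ε′≢0 with S′.string i x′
  ... | S′.infinite ε′∞ _ rewrite φ0 | ε′∞ = refl
  ... | S′.finite zero _ ε′0 _ = ⊥-elim (ε′≢0 ε′0)
  ... | S′.finite (suc _) _ ε′ _ rewrite φ0 | ε′ = refl

  f̈⊗-left : ∀ i x x′ → ε̈ Q′ i x′ ≡ fin (+ 0) → φ̈ Q i x ≢ fin (+ 0) → f̈ Q⊗Q′ i (x , x′) ≡ map (_, x′) (f̈ Q i x)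
  f̈⊗-left i x x′ ε′0 φ≢0 with S.string i x
  ... | S.infinite _ φ∞ rewrite φ∞ | ε′0 = refl
  ... | S.finite _ zero _ φ0 = ⊥-elim (φ≢0 φ0)
  ... | S.finite _ (suc _) _ φ rewrite φ | ε′0 = refl

  f̈⊗-right : ∀ i x x′ → φ̈ Q i x ≡ fin (+ 0) → f̈ Q⊗Q′ i (x , x′) ≡ map (x ,_) (f̈ Q′ i x′)
  f̈⊗-right i x x′ φ0 with S′.string i x′
  ... | S′.infinite ε′∞ _ rewrite φ0 | ε′∞ = refl
  ... | S′.finite _ _ ε′ _ rewrite φ0 | ε′ = refl

  ⊗-stuck : ∀ i x x′ → φ̈ Q i x ≢ fin (+ 0) → ε̈ Q′ i x′ ≢ fin (+ 0) →
            ë Q⊗Q′ i (x , x′) ≡ nothing × f̈ Q⊗Q′ i (x , x′) ≡ nothing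
  ⊗-stuck i x x′ φ≢0 ε′≢0 with S.string i x | S′.string i x′
  ... | S.finite _ zero _ φ0 | _ = ⊥-elim (φ≢0 φ0)
  ... | _ | S′.finite zero _ ε′0 _ = ⊥-elim (ε′≢0 ε′0)
  ... | S.infinite _ φ∞ | S′.infinite ε′∞ _ rewrite φ∞ | ε′∞ = refl , refl
  ... | S.infinite _ φ∞ | S′.finite (suc _) _ ε′ _ rewrite φ∞ | ε′ = refl , refl
  ... | S.finite _ (suc _) _ φ | S′.infinite ε′∞ _ rewrite φ | ε′∞ = refl , refl
  ... | S.finite _ (suc _) _ φ | S′.finite (suc _) _ ε′ _ rewrite φ | ε′ = refl , refl

  data ë⊗Step (i : Fin (pred n)) (x : Carrier Q) (x′ : Carrier Q′) : Carrier Q × Carrier Q′ → Set where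
    left  : ∀ {y} → ε̈ Q′ i x′ ≡ fin (+ 0) → ë Q i x ≡ just y → ë⊗Step i x x′ (y , x′)
    right : ∀ {y′} → φ̈ Q i x ≡ fin (+ 0) → ε̈ Q′ i x′ ≢ fin (+ 0) → ë Q′ i x′ ≡ just y′ → ë⊗Step i x x′ (x , y′)

  ë⊗-step : ∀ {i x x′ Y} → ë Q⊗Q′ i (x , x′) ≡ just Y → ë⊗Step i x x′ Y
  ë⊗-step {i} {x} {x′} step with ε̈ Q′ i x′ ≟∞ fin (+ 0) | φ̈ Q i x ≟∞ fin (+ 0)
  ... | yes ε′0 | _ with map≡just⇒ (_, x′) (trans (sym (ë⊗-left i x x′ ε′0)) step)
  ...   | _ , ëy , refl = left ε′0 ëy
  ë⊗-step {i} {x} {x′} step | no ε′≢0 | yes φ0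
    with map≡just⇒ (x ,_) (trans (sym (ë⊗-right i x x′ φ0 ε′≢0)) step)
  ...   | _ , ëy′ , refl = right φ0 ε′≢0 ëy′
  ë⊗-step {i} {x} {x′} step | no ε′≢0 | no φ≢0 =
    ⊥-elim (just≢nothing (trans (sym step) (proj₁ (⊗-stuck i x x′ φ≢0 ε′≢0))))

  data f̈⊗Step (i : Fin (pred n)) (x : Carrier Q) (x′ : Carrier Q′) : Carrier Q × Carrier Q′ → Set where
    left  : ∀ {y} → ε̈ Q′ i x′ ≡ fin (+ 0) → φ̈ Q i x ≢ fin (+ 0) → f̈ Q i x ≡ just y → f̈⊗Step i x x′ (y , x′)
    right : ∀ {y′} → φ̈ Q i x ≡ fin (+ 0) → f̈ Q′ i x′ ≡ just y′ → f̈⊗Step i x x′ (x , y′)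

  f̈⊗-step : ∀ {i x x′ Y} → f̈ Q⊗Q′ i (x , x′) ≡ just Y → f̈⊗Step i x x′ Y
  f̈⊗-step {i} {x} {x′} step with φ̈ Q i x ≟∞ fin (+ 0) | ε̈ Q′ i x′ ≟∞ fin (+ 0)
  ... | yes φ0 | _ with map≡just⇒ (x ,_) (trans (sym (f̈⊗-right i x x′ φ0)) step)
  ...   | _ , f̈y′ , refl = right φ0 f̈y′
  f̈⊗-step {i} {x} {x′} step | no φ≢0 | yes ε′0
    with map≡just⇒ (_, x′) (trans (sym (f̈⊗-left i x x′ ε′0 φ≢0)) step)
  ...   | _ , f̈y , refl = left ε′0 φ≢0 f̈y
  f̈⊗-step {i} {x} {x′} step | no φ≢0 | no ε′≢0 =
    ⊥-elim (just≢nothing (trans (sym step) (proj₂ (⊗-stuck i x x′ φ≢0 ε′≢0))))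

  ε⊗-congˡ : ∀ j {x z} x′ → ε̈ Q j x ≡ ε̈ Q j z → φ̈ Q j x ≡ φ̈ Q j z →
             ⟨ wt Q x , α n j ⟩ ≡ ⟨ wt Q z , α n j ⟩ → ε̈ Q⊗Q′ j (x , x′) ≡ ε̈ Q⊗Q′ j (z , x′)
  ε⊗-congˡ j x′ ε≡ φ≡ w≡ rewrite ε≡ | φ≡ | w≡ = refl

  ε⊗-congʳ : ∀ j x {x′ z′} → ε̈ Q′ j x′ ≡ ε̈ Q′ j z′ → ε̈ Q⊗Q′ j (x , x′) ≡ ε̈ Q⊗Q′ j (x , z′)
  ε⊗-congʳ j x ε′≡ rewrite ε′≡ = refl

  φ⊗-congˡ : ∀ j {x z} x′ → φ̈ Q j x ≡ φ̈ Q j z → φ̈ Q⊗Q′ j (x , x′) ≡ φ̈ Q⊗Q′ j (z , x′)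
  φ⊗-congˡ j x′ φ≡ rewrite φ≡ = refl

module TensorLocal {n : ℕ} (Q Q′ : QData n)
                   (qc : IsQuasiCrystal Q) (qs : IsSeminormal Q) (la : LocalAxioms Q)
                   (qc′ : IsQuasiCrystal Q′) (qs′ : IsSeminormal Q′) (la′ : LocalAxioms Q′) where
  open QData
  open Tensor Q Q′ qc qs qc′ qs′
  module L = LocalFacts Q qc qs la
  module L′ = LocalFacts Q′ qc′ qs′ la′

  ε⊗-change-left : ∀ {i j x x′ y} → ε̈ Q′ i x′ ≡ fin (+ 0) → ë Q i x ≡ just y → Next Q i j →
                   Change (ε̈ Q⊗Q′ j (x , x′)) (ε̈ Q⊗Q′ j (y , x′)) (ε̈ Q⊗Q′ i (y , x′))
  ε⊗-change-left {i} {j} {x} {x′} {y} ε′ᵢ0 step next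
    with L.ε-change step next | S′.φ-fin⇒ε-fin j x′ (L′.εᵢ≡0⇒φⱼ≡0 x′ next ε′ᵢ0) | S.string j x
  ... | becomes-finite c ε∞ εᵢy0 εⱼy c≢0 | a′ , ε′ⱼ | _ =
        becomes-finite (c ℕ.+ a′) (proj₁ (⊗-infiniteˡ j x x′ ε∞)) (⊗-ε≡0⇐ i y x′ εᵢy0 ε′ᵢ0)
          (proj₁ (⊗-φˡ≡0 j y x′ εⱼy (L.εᵢ≡0⇒φⱼ≡0 y next εᵢy0) ε′ⱼ (L′.εᵢ≡0⇒φⱼ≡0 x′ next ε′ᵢ0)))
          (c≢0 ∘ ℕP.m+n≡0⇒m≡0 c)
  ... | unchanged εⱼ≡ no-jump | _ | S.infinite ε∞ _ =
        unchanged (trans (proj₁ (⊗-infiniteˡ j x x′ ε∞))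
                         (sym (proj₁ (⊗-infiniteˡ j y x′ (trans (sym εⱼ≡) ε∞)))))
          (λ (_ , Z0) → no-jump (ε∞ , proj₁ (⊗-ε≡0⇒ i y x′ Z0)))
  ... | unchanged εⱼ≡ no-jump | a′ , ε′ⱼ | S.finite a b εⱼ φⱼ
    with S.ε-fixed⇒φ-drops step (inj₁ next) εⱼ φⱼ (trans (sym εⱼ≡) εⱼ) | a′ | ε′ⱼ
  ...   | d , refl , φⱼy | zero | ε′ⱼ0 =
          unchanged (trans (proj₁ (⊗-εʳ≡0 j x x′ εⱼ φⱼ ε′ⱼ0 φ′ⱼ0))
                           (sym (proj₁ (⊗-εʳ≡0 j y x′ (trans (sym εⱼ≡) εⱼ) φⱼy ε′ⱼ0 φ′ⱼ0))))
            (λ (E∞ , _) → ≡fin⇒≢∞⁺ (proj₁ (⊗-εʳ≡0 j x x′ εⱼ φⱼ ε′ⱼ0 φ′ⱼ0)) E∞)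
    where φ′ⱼ0 = L′.εᵢ≡0⇒φⱼ≡0 x′ next ε′ᵢ0
  ...   | suc d , refl , φⱼy | suc _ | ε′ⱼ =
          unchanged (trans (proj₁ (⊗-blocked j x x′ φⱼ ε′ⱼ)) (sym (proj₁ (⊗-blocked j y x′ φⱼy ε′ⱼ))))
            (λ (_ , Z0) → ≡0⇒≢suc (L.εᵢ≡0⇒φⱼ≡0 y next (proj₁ (⊗-ε≡0⇒ i y x′ Z0))) φⱼy)
  ...   | zero , refl , φⱼy | suc a₀ | ε′ⱼ =
          becomes-finite (a ℕ.+ suc a₀) (proj₁ (⊗-blocked j x x′ φⱼ ε′ⱼ))
            (⊗-ε≡0⇐ i y x′ (L.φⱼ≡0⇒εᵢ≡0 y next φⱼy) ε′ᵢ0)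
            (proj₁ (⊗-φˡ≡0 j y x′ (trans (sym εⱼ≡) εⱼ) φⱼy ε′ⱼ (L′.εᵢ≡0⇒φⱼ≡0 x′ next ε′ᵢ0))) (ℕP.m+1+n≢0 a)

  ε⊗-change-right : ∀ {i j x x′ y′} → φ̈ Q i x ≡ fin (+ 0) → ε̈ Q′ i x′ ≢ fin (+ 0) →
                    ë Q′ i x′ ≡ just y′ → Next Q i j →
                    Change (ε̈ Q⊗Q′ j (x , x′)) (ε̈ Q⊗Q′ j (x , y′)) (ε̈ Q⊗Q′ i (x , y′))
  ε⊗-change-right {i} {j} {x} {x′} {y′} φᵢ0 ε′ᵢ≢0 step next with L′.ε-change step next
  ... | becomes-finite c ε′∞ ε′ᵢy′0 ε′ⱼy′ c≢0 with ε̈ Q i x ≟∞ fin (+ 0)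
  ...   | yes εᵢ0 with S.φ-fin⇒ε-fin j x (L.εᵢ≡0⇒φⱼ≡0 x next εᵢ0)
  ...     | a , εⱼ =
            becomes-finite (a ℕ.+ c) (proj₁ (⊗-infiniteʳ j x x′ ε′∞)) (⊗-ε≡0⇐ i x y′ εᵢ0 ε′ᵢy′0)
              (proj₁ (⊗-φˡ≡0 j x y′ εⱼ (L.εᵢ≡0⇒φⱼ≡0 x next εᵢ0) ε′ⱼy′ (proj₂ (S′.ε-fin⇒φ-fin j y′ ε′ⱼy′))))
              (c≢0 ∘ ℕP.m+n≡0⇒n≡0 a)
  ε⊗-change-right {i} {j} {x} {x′} {y′} φᵢ0 ε′ᵢ≢0 step next
      | becomes-finite c ε′∞ ε′ᵢy′0 ε′ⱼy′ c≢0 | no εᵢ≢0 =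
        unchanged (trans (proj₁ (⊗-infiniteʳ j x x′ ε′∞)) (sym (E′∞ c ε′ⱼy′ c≢0)))
          (λ (_ , Z0) → εᵢ≢0 (proj₁ (⊗-ε≡0⇒ i x y′ Z0)))
    where
    E′∞ : ∀ c → ε̈ Q′ j y′ ≡ fin (+ c) → c ≢ 0 → ε̈ Q⊗Q′ j (x , y′) ≡ ∞⁺
    E′∞ c ε′ⱼy′ c≢0 with S.string j x | c
    ... | S.infinite ε∞ _ | _ = proj₁ (⊗-infiniteˡ j x y′ ε∞)
    ... | S.finite _ zero _ φⱼ0 | _ = ⊥-elim (εᵢ≢0 (L.φⱼ≡0⇒εᵢ≡0 x next φⱼ0))
    ... | S.finite _ (suc _) _ _ | zero = ⊥-elim (c≢0 refl)
    ... | S.finite _ (suc _) _ φⱼ | suc _ = proj₁ (⊗-blocked j x y′ φⱼ ε′ⱼy′)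
  ε⊗-change-right {i} {j} {x} {x′} {y′} φᵢ0 ε′ᵢ≢0 step next | unchanged ε′ⱼ≡ no-jump =
    unchanged (ε⊗-congʳ j x ε′ⱼ≡) no-collapse
    where
    no-collapse : ¬ (ε̈ Q⊗Q′ j (x , x′) ≡ ∞⁺ × ε̈ Q⊗Q′ i (x , y′) ≡ fin (+ 0))
    no-collapse (E∞ , Z0) with ⊗-ε≡0⇒ i x y′ Z0 | S′.string j x′
    ... | _ , ε′ᵢy′0 | S′.infinite ε′∞ _ = no-jump (ε′∞ , ε′ᵢy′0)
    ... | εᵢ0 , _ | S′.finite _ _ ε′ⱼ φ′ⱼ =
          ≡fin⇒≢∞⁺ (proj₁ (⊗-φˡ≡0 j x x′ (proj₂ (S.φ-fin⇒ε-fin j x φⱼ0)) φⱼ0 ε′ⱼ φ′ⱼ)) E∞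
      where φⱼ0 = L.εᵢ≡0⇒φⱼ≡0 x next εᵢ0

  φ⊗-change-left : ∀ {i j x x′ y} → ε̈ Q′ i x′ ≡ fin (+ 0) → ë Q i x ≡ just y → Next Q j i →
                   Change (φ̈ Q⊗Q′ j (y , x′)) (φ̈ Q⊗Q′ j (x , x′)) (φ̈ Q⊗Q′ i (x , x′))
  φ⊗-change-left {i} {j} {x} {x′} {y} ε′ᵢ0 step next with L.φ-change step next
  ... | unchanged φⱼ≡ no-jump = unchanged (φ⊗-congˡ j x′ φⱼ≡) no-collapse
    where
    no-collapse : ¬ (φ̈ Q⊗Q′ j (y , x′) ≡ ∞⁺ × φ̈ Q⊗Q′ i (x , x′) ≡ fin (+ 0))
    no-collapse (E∞ , Z0) with ⊗-φ≡0⇒ i x x′ Z0 | S.string j y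
    ... | φᵢ0 , _ | S.infinite _ φ∞ = no-jump (φ∞ , φᵢ0)
    ... | _ , φ′ᵢ0 | S.finite _ _ εⱼy φⱼy =
          ≡fin⇒≢∞⁺ (proj₂ (⊗-εʳ≡0 j y x′ εⱼy φⱼy ε′ⱼ0 (proj₂ (S′.ε-fin⇒φ-fin j x′ ε′ⱼ0)))) E∞
      where ε′ⱼ0 = L′.φⱼ≡0⇒εᵢ≡0 x′ next φ′ᵢ0
  ... | becomes-finite m φ∞ φᵢ0 φⱼx m≢0 with S.φ-fin⇒ε-fin j x φⱼx | S′.string j x′
  ...   | _ , εⱼ | S′.finite zero _ ε′ⱼ0 φ′ⱼ =
          becomes-finite (m ℕ.+ _) E∞ (⊗-φ≡0⇐ i x x′ φᵢ0 (L′.εᵢ≡0⇒φⱼ≡0 x′ next ε′ⱼ0))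
            (proj₂ (⊗-εʳ≡0 j x x′ εⱼ φⱼx ε′ⱼ0 φ′ⱼ)) (m≢0 ∘ ℕP.m+n≡0⇒m≡0 m)
    where E∞ = proj₂ (⊗-infiniteˡ j y x′ (S.φ∞⇒ε∞ j y φ∞))
  ...   | _ , εⱼ | S′.infinite ε′∞ _ =
          unchanged (trans (proj₂ (⊗-infiniteˡ j y x′ (S.φ∞⇒ε∞ j y φ∞)))
                           (sym (proj₂ (⊗-infiniteʳ j x x′ ε′∞))))
            (λ (_ , Z0) → ≡fin⇒≢∞⁺ (L′.φⱼ≡0⇒εᵢ≡0 x′ next (proj₂ (⊗-φ≡0⇒ i x x′ Z0))) ε′∞)
  ...   | _ , εⱼ | S′.finite (suc _) _ ε′ⱼ _ with m
  ...     | zero = ⊥-elim (m≢0 refl)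
  ...     | suc _ =
          unchanged (trans (proj₂ (⊗-infiniteˡ j y x′ (S.φ∞⇒ε∞ j y φ∞)))
                           (sym (proj₂ (⊗-blocked j x x′ φⱼx ε′ⱼ))))
            (λ (_ , Z0) → ≡0⇒≢suc (L′.φⱼ≡0⇒εᵢ≡0 x′ next (proj₂ (⊗-φ≡0⇒ i x x′ Z0))) ε′ⱼ)

  φ⊗-change-right : ∀ {i j x x′ y′} → φ̈ Q i x ≡ fin (+ 0) → ë Q′ i x′ ≡ just y′ → Next Q j i →
                    Change (φ̈ Q⊗Q′ j (x , y′)) (φ̈ Q⊗Q′ j (x , x′)) (φ̈ Q⊗Q′ i (x , x′))
  φ⊗-change-right {i} {j} {x} {x′} {y′} φᵢ0 step next
    with L.φⱼ≡0⇒εᵢ≡0 x next φᵢ0 | S.ε-fin⇒φ-fin j x (L.φⱼ≡0⇒εᵢ≡0 x next φᵢ0) | L′.φ-change step next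
  ... | εⱼ0 | b , φⱼ | becomes-finite m φ′∞ φ′ᵢ0 φ′ⱼx′ m≢0 =
        becomes-finite (b ℕ.+ m) (proj₂ (⊗-infiniteʳ j x y′ (S′.φ∞⇒ε∞ j y′ φ′∞)))
          (⊗-φ≡0⇐ i x x′ φᵢ0 φ′ᵢ0)
          (proj₂ (⊗-εʳ≡0 j x x′ εⱼ0 φⱼ (L′.φⱼ≡0⇒εᵢ≡0 x′ next φ′ᵢ0) φ′ⱼx′)) (m≢0 ∘ ℕP.m+n≡0⇒n≡0 b)
  ... | εⱼ0 | b , φⱼ | unchanged φ′ⱼ≡ no-jump with S′.string j x′
  ...   | S′.infinite ε′∞ φ′∞ =
          unchanged (trans (proj₂ (⊗-infiniteʳ j x y′ (S′.φ∞⇒ε∞ j y′ (trans φ′ⱼ≡ φ′∞))))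
                           (sym (proj₂ (⊗-infiniteʳ j x x′ ε′∞))))
            (λ (_ , Z0) → ≡fin⇒≢∞⁺ (L′.φⱼ≡0⇒εᵢ≡0 x′ next (proj₂ (⊗-φ≡0⇒ i x x′ Z0))) ε′∞)
  ...   | S′.finite a′ b′ ε′ⱼ φ′ⱼ
    with S′.φ-fixed⇒ε-rises step (inj₂ next) ε′ⱼ φ′ⱼ (trans φ′ⱼ≡ φ′ⱼ) | b | φⱼ | a′ | ε′ⱼ
  ...     | ε′ⱼy′ | zero | φⱼ0 | _ | ε′ⱼ =
            unchanged (trans (proj₂ (⊗-φˡ≡0 j x y′ εⱼ0 φⱼ0 ε′ⱼy′ (trans φ′ⱼ≡ φ′ⱼ)))
                             (sym (proj₂ (⊗-φˡ≡0 j x x′ εⱼ0 φⱼ0 ε′ⱼ φ′ⱼ))))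
              (λ (E∞ , _) → ≡fin⇒≢∞⁺ (proj₂ (⊗-φˡ≡0 j x y′ εⱼ0 φⱼ0 ε′ⱼy′ (trans φ′ⱼ≡ φ′ⱼ))) E∞)
  ...     | ε′ⱼy′ | suc b₀ | φⱼ | zero | ε′ⱼ0 =
            becomes-finite (suc b₀ ℕ.+ b′) (proj₂ (⊗-blocked j x y′ φⱼ ε′ⱼy′))
              (⊗-φ≡0⇐ i x x′ φᵢ0 (L′.εᵢ≡0⇒φⱼ≡0 x′ next ε′ⱼ0))
              (proj₂ (⊗-εʳ≡0 j x x′ εⱼ0 φⱼ ε′ⱼ0 φ′ⱼ)) (λ ())
  ...     | ε′ⱼy′ | suc _ | φⱼ | suc _ | ε′ⱼ =
            unchanged (trans (proj₂ (⊗-blocked j x y′ φⱼ ε′ⱼy′)) (sym (proj₂ (⊗-blocked j x x′ φⱼ ε′ⱼ))))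
              (λ (_ , Z0) → ≡0⇒≢suc (L′.φⱼ≡0⇒εᵢ≡0 x′ next (proj₂ (⊗-φ≡0⇒ i x x′ Z0))) ε′ⱼ)

  far-or-adjacent : ∀ {i j} → i ≢ j → Far Q i j ⊎ Next Q i j ⊎ Next Q j i
  far-or-adjacent {i} {j} i≢j with ℕP.<-cmp (toℕ i) (toℕ j)
  ... | tri≈ _ i≡j _ = ⊥-elim (i≢j (toℕ-injective i≡j))
  ... | tri< i<j _ _ with ℕP.m≤n⇒m<n∨m≡n i<j
  ...   | inj₁ 1+i<j = inj₁ (inj₁ 1+i<j)
  ...   | inj₂ 1+i≡j = inj₂ (inj₁ (sym 1+i≡j))
  far-or-adjacent {i} {j} i≢j | tri> _ _ j<i with ℕP.m≤n⇒m<n∨m≡n j<i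
  ...   | inj₁ 1+j<i = inj₁ (inj₂ 1+j<i)
  ...   | inj₂ 1+j≡i = inj₂ (inj₂ (sym 1+j≡i))

  ë-cross : ∀ {i j x x′ y z′} → i ≢ j → ë Q i x ≡ just y → ε̈ Q′ i x′ ≡ fin (+ 0) →
            ë Q′ j x′ ≡ just z′ → φ̈ Q j x ≡ fin (+ 0) → ε̈ Q′ i z′ ≡ fin (+ 0) × φ̈ Q j y ≡ fin (+ 0)
  ë-cross {x = x} i≢j stepᵢ ε′ᵢ0 stepⱼ φⱼ0 with far-or-adjacent i≢j
  ... | inj₁ far = trans (sym (L′.ε-far stepⱼ (swap far))) ε′ᵢ0 , trans (L.φ-far stepᵢ far) φⱼ0
  ... | inj₂ (inj₁ next) = ⊥-elim (S.ë-defined⇒ε≢0 stepᵢ (L.φⱼ≡0⇒εᵢ≡0 x next φⱼ0))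
  ... | inj₂ (inj₂ next) = Change-preserves-0 (L′.ε-change stepⱼ next) ε′ᵢ0 ,
                           Change-reflects-0 (L.φ-change stepᵢ next) φⱼ0

  f̈-cross : ∀ {i j x x′ y z′} → i ≢ j → f̈ Q i x ≡ just y → ε̈ Q′ i x′ ≡ fin (+ 0) →
            f̈ Q′ j x′ ≡ just z′ → φ̈ Q j x ≡ fin (+ 0) → ε̈ Q′ i z′ ≡ fin (+ 0) × φ̈ Q j y ≡ fin (+ 0)
  f̈-cross {i} {j} {x} {x′} {y} {z′} i≢j stepᵢ ε′ᵢ0 stepⱼ φⱼ0 with far-or-adjacent i≢j
  ... | inj₁ far = trans (L′.ε-far ëⱼ (swap far)) ε′ᵢ0 , trans (sym (L.φ-far ëᵢ far)) φⱼ0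
    where
    ëᵢ = IsQuasiCrystal.Q1⇐ qc i y x stepᵢ
    ëⱼ = IsQuasiCrystal.Q1⇐ qc′ j z′ x′ stepⱼ
  ... | inj₂ (inj₁ next) = ⊥-elim (S′.f̈-defined⇒φ≢0 stepⱼ (L′.εᵢ≡0⇒φⱼ≡0 x′ next ε′ᵢ0))
  ... | inj₂ (inj₂ next) = Change-reflects-0 (L′.ε-change ëⱼ next) ε′ᵢ0 ,
                           Change-preserves-0 (L.φ-change ëᵢ next) φⱼ0
    where
    ëᵢ = IsQuasiCrystal.Q1⇐ qc i y x stepᵢ
    ëⱼ = IsQuasiCrystal.Q1⇐ qc′ j z′ x′ stepⱼ

  ⊗-LQ1 : ∀ i j X → Next Q i j → (ε̈ Q⊗Q′ i X ≡ fin (+ 0) → φ̈ Q⊗Q′ j X ≡ fin (+ 0))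
                                × (φ̈ Q⊗Q′ j X ≡ fin (+ 0) → ε̈ Q⊗Q′ i X ≡ fin (+ 0))
  ⊗-LQ1 i j (x , x′) next =
    (λ ε⊗0 → let (ε0 , ε′0) = ⊗-ε≡0⇒ i x x′ ε⊗0 in
             ⊗-φ≡0⇐ j x x′ (L.εᵢ≡0⇒φⱼ≡0 x next ε0) (L′.εᵢ≡0⇒φⱼ≡0 x′ next ε′0)) ,
    (λ φ⊗0 → let (φ0 , φ′0) = ⊗-φ≡0⇒ j x x′ φ⊗0 in
             ⊗-ε≡0⇐ i x x′ (L.φⱼ≡0⇒εᵢ≡0 x next φ0) (L′.φⱼ≡0⇒εᵢ≡0 x′ next φ′0))

  ⊗-LQ2-1 : ∀ i j X Y → ë Q⊗Q′ i X ≡ just Y → Far Q i j → ε̈ Q⊗Q′ j X ≡ ε̈ Q⊗Q′ j Y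
  ⊗-LQ2-1 i j (x , x′) Y step far with ë⊗-step step
  ... | left _ ëy = ε⊗-congˡ j x′ (L.ε-far ëy far) (sym (L.φ-far ëy far)) (sym (S.⟨wt,α⟩-far j ëy far))
  ... | right _ _ ëy′ = ε⊗-congʳ j x (L′.ε-far ëy′ far)

  ⊗-LQ2-2 : ∀ i j X Y → ë Q⊗Q′ i X ≡ just Y → Next Q i j →
              ((ε̈ Q⊗Q′ j X ≢ ε̈ Q⊗Q′ j Y) → (ε̈ Q⊗Q′ j X ≡ ∞⁺ × ε̈ Q⊗Q′ i Y ≡ fin (+ 0)))
            × ((ε̈ Q⊗Q′ j X ≡ ∞⁺ × ε̈ Q⊗Q′ i Y ≡ fin (+ 0)) → (ε̈ Q⊗Q′ j X ≢ ε̈ Q⊗Q′ j Y))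
            × ((ε̈ Q⊗Q′ j X ≢ ε̈ Q⊗Q′ j Y) → ε̈ Q⊗Q′ j Y ≢ fin (+ 0))
  ⊗-LQ2-2 i j (x , x′) Y step next with ë⊗-step step
  ... | left ε′0 ëy = Change⇒LQ2-2 (ε⊗-change-left ε′0 ëy next)
  ... | right φ0 ε′≢0 ëy′ = Change⇒LQ2-2 (ε⊗-change-right φ0 ε′≢0 ëy′ next)

  ⊗-LQ2-3 : ∀ i j X Y → ë Q⊗Q′ i X ≡ just Y → Next Q j i →
              ((φ̈ Q⊗Q′ j X ≢ φ̈ Q⊗Q′ j Y) → (φ̈ Q⊗Q′ j Y ≡ ∞⁺ × φ̈ Q⊗Q′ i X ≡ fin (+ 0)))
            × ((φ̈ Q⊗Q′ j Y ≡ ∞⁺ × φ̈ Q⊗Q′ i X ≡ fin (+ 0)) → (φ̈ Q⊗Q′ j X ≢ φ̈ Q⊗Q′ j Y))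
            × ((φ̈ Q⊗Q′ j X ≢ φ̈ Q⊗Q′ j Y) → φ̈ Q⊗Q′ j X ≢ fin (+ 0))
  ⊗-LQ2-3 i j (x , x′) Y step next with ë⊗-step step
  ... | left ε′0 ëy = Change⇒LQ2-3 (φ⊗-change-left ε′0 ëy next)
  ... | right φ0 _ ëy′ = Change⇒LQ2-3 (φ⊗-change-right φ0 ëy′ next)

  ⊗-LQ3 : ∀ i j X → i ≢ j → ë Q⊗Q′ i X ≢ nothing → ë Q⊗Q′ j X ≢ nothing →
          Commute (ë Q⊗Q′ i) (ë Q⊗Q′ j) X
  ⊗-LQ3 i j (x , x′) i≢j definedᵢ definedⱼ with ≢nothing⇒just definedᵢ | ≢nothing⇒just definedⱼ
  ... | _ , stepᵢ | _ , stepⱼ with ë⊗-step stepᵢ | ë⊗-step stepⱼ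
  ...   | left ε′ᵢ0 ëᵢ | left ε′ⱼ0 ëⱼ with L.ë-square i≢j ëᵢ ëⱼ
  ...     | _ , ëⱼy , ëᵢz = square⇒Commute (ë Q⊗Q′ i) (ë Q⊗Q′ j) stepᵢ stepⱼ
              (trans (ë⊗-left j _ x′ ε′ⱼ0) (map-just ëⱼy)) (trans (ë⊗-left i _ x′ ε′ᵢ0) (map-just ëᵢz))
  ⊗-LQ3 i j (x , x′) i≢j _ _ | _ , stepᵢ | _ , stepⱼ | right φᵢ0 _ ëᵢ | right φⱼ0 _ ëⱼ
    with L′.ë-square i≢j ëᵢ ëⱼ
  ...     | _ , ëⱼy′ , ëᵢz′ = square⇒Commute (ë Q⊗Q′ i) (ë Q⊗Q′ j) stepᵢ stepⱼ
              (trans (ë⊗-right j x _ φⱼ0 (S′.ë-defined⇒ε≢0 ëⱼy′)) (map-just ëⱼy′))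
              (trans (ë⊗-right i x _ φᵢ0 (S′.ë-defined⇒ε≢0 ëᵢz′)) (map-just ëᵢz′))
  ⊗-LQ3 i j (x , x′) i≢j _ _ | _ , stepᵢ | _ , stepⱼ | left ε′ᵢ0 ëᵢ | right φⱼ0 ε′ⱼ≢0 ëⱼ
    with ë-cross i≢j ëᵢ ε′ᵢ0 ëⱼ φⱼ0
  ...     | ε′ᵢz′0 , φⱼy0 = square⇒Commute (ë Q⊗Q′ i) (ë Q⊗Q′ j) stepᵢ stepⱼ
              (trans (ë⊗-right j _ x′ φⱼy0 ε′ⱼ≢0) (map-just ëⱼ)) (trans (ë⊗-left i x _ ε′ᵢz′0) (map-just ëᵢ))
  ⊗-LQ3 i j (x , x′) i≢j _ _ | _ , stepᵢ | _ , stepⱼ | right φᵢ0 ε′ᵢ≢0 ëᵢ | left ε′ⱼ0 ëⱼ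
    with ë-cross (≢-sym i≢j) ëⱼ ε′ⱼ0 ëᵢ φᵢ0
  ...     | ε′ⱼy′0 , φᵢz0 = square⇒Commute (ë Q⊗Q′ i) (ë Q⊗Q′ j) stepᵢ stepⱼ
              (trans (ë⊗-left j x _ ε′ⱼy′0) (map-just ëⱼ)) (trans (ë⊗-right i _ x′ φᵢz0 ε′ᵢ≢0) (map-just ëᵢ))

  ⊗-LQ3′ : ∀ i j X → i ≢ j → f̈ Q⊗Q′ i X ≢ nothing → f̈ Q⊗Q′ j X ≢ nothing →
           Commute (f̈ Q⊗Q′ i) (f̈ Q⊗Q′ j) X
  ⊗-LQ3′ i j (x , x′) i≢j definedᵢ definedⱼ with ≢nothing⇒just definedᵢ | ≢nothing⇒just definedⱼ
  ... | _ , stepᵢ | _ , stepⱼ with f̈⊗-step stepᵢ | f̈⊗-step stepⱼ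
  ...   | left ε′ᵢ0 _ f̈ᵢ | left ε′ⱼ0 _ f̈ⱼ with L.f̈-square i≢j f̈ᵢ f̈ⱼ
  ...     | _ , f̈ⱼy , f̈ᵢz = square⇒Commute (f̈ Q⊗Q′ i) (f̈ Q⊗Q′ j) stepᵢ stepⱼ
              (trans (f̈⊗-left j _ x′ ε′ⱼ0 (S.f̈-defined⇒φ≢0 f̈ⱼy)) (map-just f̈ⱼy))
              (trans (f̈⊗-left i _ x′ ε′ᵢ0 (S.f̈-defined⇒φ≢0 f̈ᵢz)) (map-just f̈ᵢz))
  ⊗-LQ3′ i j (x , x′) i≢j _ _ | _ , stepᵢ | _ , stepⱼ | right φᵢ0 f̈ᵢ | right φⱼ0 f̈ⱼ
    with L′.f̈-square i≢j f̈ᵢ f̈ⱼ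
  ...     | _ , f̈ⱼy′ , f̈ᵢz′ = square⇒Commute (f̈ Q⊗Q′ i) (f̈ Q⊗Q′ j) stepᵢ stepⱼ
              (trans (f̈⊗-right j x _ φⱼ0) (map-just f̈ⱼy′)) (trans (f̈⊗-right i x _ φᵢ0) (map-just f̈ᵢz′))
  ⊗-LQ3′ i j (x , x′) i≢j _ _ | _ , stepᵢ | _ , stepⱼ | left ε′ᵢ0 φᵢ≢0 f̈ᵢ | right φⱼ0 f̈ⱼ
    with f̈-cross i≢j f̈ᵢ ε′ᵢ0 f̈ⱼ φⱼ0
  ...     | ε′ᵢz′0 , φⱼy0 = square⇒Commute (f̈ Q⊗Q′ i) (f̈ Q⊗Q′ j) stepᵢ stepⱼ
              (trans (f̈⊗-right j _ x′ φⱼy0) (map-just f̈ⱼ)) (trans (f̈⊗-left i x _ ε′ᵢz′0 φᵢ≢0) (map-just f̈ᵢ))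
  ⊗-LQ3′ i j (x , x′) i≢j _ _ | _ , stepᵢ | _ , stepⱼ | right φᵢ0 f̈ᵢ | left ε′ⱼ0 φⱼ≢0 f̈ⱼ
    with f̈-cross (≢-sym i≢j) f̈ⱼ ε′ⱼ0 f̈ᵢ φᵢ0
  ...     | ε′ⱼy′0 , φᵢz0 = square⇒Commute (f̈ Q⊗Q′ i) (f̈ Q⊗Q′ j) stepᵢ stepⱼ
              (trans (f̈⊗-left j x _ ε′ⱼy′0 φⱼ≢0) (map-just f̈ⱼ)) (trans (f̈⊗-right i _ x′ φᵢz0) (map-just f̈ᵢ))

  ⊗-localAxioms : LocalAxioms Q⊗Q′
  ⊗-localAxioms = record
    { LQ1 = ⊗-LQ1 ; LQ2-1 = ⊗-LQ2-1 ; LQ2-2 = ⊗-LQ2-2 ; LQ2-3 = ⊗-LQ2-3 ; LQ3 = ⊗-LQ3 ; LQ3′ = ⊗-LQ3′ }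

-- The bound 2 ≤ n only makes I non-empty; the argument does not use it.
theorem3p13 : (n : ℕ) → 2 ≤ n → (Q Q′ : QData n) →
    IsQuasiCrystal Q → IsSeminormal Q → LocalAxioms Q →
    IsQuasiCrystal Q′ → IsSeminormal Q′ → LocalAxioms Q′ →
    LocalAxioms (Q ⊗̈ Q′)
theorem3p13 n _ Q Q′ qc qs la qc′ qs′ la′ = TensorLocal.⊗-localAxioms Q Q′ qc qs la qc′ qs′ la′
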